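{- In a dagger kernel category $\mathbf{D}$, the morphisms of the form $e_f$ for some morphism $f$ of $\mathbf{D}$ are precisely the zero-epis.
   Context: A dagger category is a category with a contravariant functor $\dagger$ that is the identity on objects with $f^{\dagger\dagger}=f$; $f$ is a dagger mono if $f^\dagger\circ f=\mathrm{id}$. A dagger kernel category is a dagger category with a zero object $0$ in which every morphism $f$ has a kernel (universal $k$ with $f\circ k=0$) that can be chosen to be a dagger mono, denoted $\ker(f)$; $\mathrm{coker}(f)=\ker(f^\dagger)^\dagger$. For $f\colon X\to Y$, the image $i_f\colon\mathrm{Im}(f)\to Y$ is $\ker(\mathrm{coker}(f))$, chosen dagger monic, and $e_f\colon X\to\mathrm{Im}(f)$ is the unique morphism with $i_f\circ e_f=f$; explicitly $e_f=(i_f)^\dagger\circ f$. A morphism $e$ is a zero-epi if $g\circ e=0$ implies $g=0$ for every morphism $g$. -}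

module Defs where

open import Level using (Level; _⊔_; suc)
open import Data.Product using (Σ; ∃; _×_; _,_)
open import Relation.Binary using (IsEquivalence)

record Category (o h e : Level) : Set (suc (o ⊔ h ⊔ e)) where
  infixr 9 _∘_
  infix 4 _≈_
  field
    Obj   : Set o
    Hom   : Obj → Obj → Set h
    _≈_   : ∀ {A B} → Hom A B → Hom A B → Set e
    ≈-equiv : ∀ {A B} → IsEquivalence (_≈_ {A} {B})
    id    : ∀ {A} → Hom A A
    _∘_   : ∀ {A B C} → Hom B C → Hom A B → Hom A C
    assoc : ∀ {A B C D} (f : Hom A B) (g : Hom B C) (k : Hom C D) →
            (k ∘ g) ∘ f ≈ k ∘ (g ∘ f)
    identityˡ : ∀ {A B} (f : Hom A B) → id ∘ f ≈ f
    identityʳ : ∀ {A B} (f : Hom A B) → f ∘ id ≈ f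
    ∘-resp-≈ : ∀ {A B C} {f f′ : Hom B C} {g g′ : Hom A B} →
               f ≈ f′ → g ≈ g′ → f ∘ g ≈ f′ ∘ g′

record DaggerCategory (o h e : Level) : Set (suc (o ⊔ h ⊔ e)) where
  field
    cat : Category o h e
  open Category cat public
  field
    _† : ∀ {A B} → Hom A B → Hom B A
    †-resp-≈ : ∀ {A B} {f g : Hom A B} → f ≈ g → f † ≈ g †
    †-identity : ∀ {A} → (id {A}) † ≈ id
    †-homomorphism : ∀ {A B C} (f : Hom A B) (g : Hom B C) →
                     (g ∘ f) † ≈ (f †) ∘ (g †)
    †-involutive : ∀ {A B} (f : Hom A B) → (f †) † ≈ f

  IsDaggerMono : ∀ {A B} → Hom A B → Set e
  IsDaggerMono f = (f †) ∘ f ≈ id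

record DaggerKernelCategory (o h e : Level) : Set (suc (o ⊔ h ⊔ e)) where
  field
    dagger : DaggerCategory o h e
  open DaggerCategory dagger public
  field
    𝟘 : Obj
    ¡ : ∀ {A} → Hom 𝟘 A
    ¡-unique : ∀ {A} (f : Hom 𝟘 A) → f ≈ ¡
    ! : ∀ {A} → Hom A 𝟘
    !-unique : ∀ {A} (f : Hom A 𝟘) → f ≈ !

  zero : ∀ {A B} → Hom A B
  zero = ¡ ∘ !

  IsKernel : ∀ {K X Y} → Hom X Y → Hom K X → Set (o ⊔ h ⊔ e)
  IsKernel {K} {X} {Y} f k =
    (f ∘ k ≈ zero) ×
    (∀ {Z} (g : Hom Z X) → f ∘ g ≈ zero →
       Σ (Hom Z K) λ u → (k ∘ u ≈ g) × (∀ (u′ : Hom Z K) → k ∘ u′ ≈ g → u′ ≈ u))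

  field
    KerObj : ∀ {X Y} → Hom X Y → Obj
    ker : ∀ {X Y} (f : Hom X Y) → Hom (KerObj f) X
    ker-isKernel : ∀ {X Y} (f : Hom X Y) → IsKernel f (ker f)
    ker-daggerMono : ∀ {X Y} (f : Hom X Y) → IsDaggerMono (ker f)

  CokerObj : ∀ {X Y} → Hom X Y → Obj
  CokerObj f = KerObj (f †)

  coker : ∀ {X Y} (f : Hom X Y) → Hom Y (CokerObj f)
  coker f = (ker (f †)) †

  Im : ∀ {X Y} → Hom X Y → Obj
  Im f = KerObj (coker f)

  i[_] : ∀ {X Y} (f : Hom X Y) → Hom (Im f) Y
  i[ f ] = ker (coker f)

  e[_] : ∀ {X Y} (f : Hom X Y) → Hom X (Im f)
  e[ f ] = (i[ f ] †) ∘ f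

  IsZeroEpi : ∀ {A B} → Hom A B → Set (o ⊔ h ⊔ e)
  IsZeroEpi {A} {B} e = ∀ {C} (g : Hom B C) → g ∘ e ≈ zero → g ≈ zero

  -- e : A → B is of the form e_f: for some f : A → Y and some choice
  -- i : B → Y of the image of f (a dagger-mono kernel of coker f),
  -- e = i† ∘ f
  IsImageFactor : ∀ {A B} → Hom A B → Set (o ⊔ h ⊔ e)
  IsImageFactor {A} {B} e =
    Σ Obj λ Y → Σ (Hom A Y) λ f → Σ (Hom B Y) λ i →
      IsKernel (coker f) i × IsDaggerMono i × (e ≈ (i †) ∘ f)

-- (⇒) If i is a dagger mono with coker f ∘ i ≈ 0, then i† ∘ f is a
--     zero-epi: from g ∘ i† ∘ f ≈ 0 we get g ∘ i† ≈ u† ∘ coker f, hence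
--     g ≈ g ∘ i† ∘ i ≈ u† ∘ coker f ∘ i ≈ 0.
-- (⇐) If m is a zero-epi, then coker m ≈ 0, since coker m ∘ m ≈ 0.  The
--     identity is a dagger-mono kernel of any zero morphism, so id is an
--     image of m and m ≈ id† ∘ m exhibits m as its own image factor.
module Submission where

open import Defs
open import Level using (Level)
open import Data.Product using (_×_; _,_; Σ; proj₁)
open import Relation.Binary using (Setoid; IsEquivalence)
import Relation.Binary.Reasoning.Setoid as SetoidReasoning

module DaggerKernelFacts {o h e : Level} (D : DaggerKernelCategory o h e) where
  open DaggerKernelCategory D

  homSetoid : Obj → Obj → Setoid h e
  homSetoid A B = record { Carrier = Hom A B ; _≈_ = _≈_ ; isEquivalence = ≈-equiv }

  module _ {A B : Obj} where
    open IsEquivalence (≈-equiv {A} {B}) public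
      using () renaming (refl to ≈-refl; sym to ≈-sym; trans to ≈-trans)

  module HomReasoning {A B : Obj} = SetoidReasoning (homSetoid A B)
  open HomReasoning

  zeroˡ : ∀ {A B C} (f : Hom A B) → zero {B} {C} ∘ f ≈ zero
  zeroˡ f = ≈-trans (assoc f ! ¡) (∘-resp-≈ ≈-refl (!-unique (! ∘ f)))

  zeroʳ : ∀ {A B C} (f : Hom B C) → f ∘ zero {A} {B} ≈ zero
  zeroʳ f = ≈-trans (≈-sym (assoc ! ¡ f)) (∘-resp-≈ (¡-unique (f ∘ ¡)) ≈-refl)

  zero† : ∀ {A B} → zero {A} {B} † ≈ zero
  zero† = ≈-trans (†-homomorphism ! ¡) (∘-resp-≈ (¡-unique (! †)) (!-unique (¡ †)))

  annihilates† : ∀ {X Y Z} {f : Hom X Y} {k : Hom Y Z} →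
                 k ∘ f ≈ zero → f † ∘ k † ≈ zero
  annihilates† {f = f} {k} kf≈0 = begin
    f † ∘ k †   ≈⟨ ≈-sym (†-homomorphism f k) ⟩
    (k ∘ f) †   ≈⟨ †-resp-≈ kf≈0 ⟩
    zero †      ≈⟨ zero† ⟩
    zero        ∎

  coker-annihilates : ∀ {X Y} (f : Hom X Y) → coker f ∘ f ≈ zero
  coker-annihilates f = begin
    coker f ∘ f           ≈⟨ ∘-resp-≈ ≈-refl (≈-sym (†-involutive f)) ⟩
    ker (f †) † ∘ f † †   ≈⟨ annihilates† (proj₁ (ker-isKernel (f †))) ⟩
    zero                  ∎

  -- Every morphism annihilating f factors through coker f (the dual of
  -- the universal property of ker f†).
  coker-factor : ∀ {X Y Z} (f : Hom X Y) (k : Hom Y Z) → k ∘ f ≈ zero →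
                 Σ (Hom Z (CokerObj f)) λ u → k ≈ u † ∘ coker f
  coker-factor f k kf≈0 with ker-isKernel (f †)
  ... | _ , universal with universal (k †) (annihilates† kf≈0)
  ...   | u , ker∘u≈k† , _ = u , (begin
    k                     ≈⟨ ≈-sym (†-involutive k) ⟩
    k † †                 ≈⟨ †-resp-≈ (≈-sym ker∘u≈k†) ⟩
    (ker (f †) ∘ u) †     ≈⟨ †-homomorphism u (ker (f †)) ⟩
    u † ∘ coker f         ∎)

  -- (⇒) If i is a dagger mono annihilated by coker f, then i† ∘ f is a
  -- zero-epi.
  daggerMono-restriction-isZeroEpi :
    ∀ {A B Y} (f : Hom A Y) (i : Hom B Y) →
    coker f ∘ i ≈ zero → IsDaggerMono i → IsZeroEpi (i † ∘ f)
  daggerMono-restriction-isZeroEpi f i cokerf∘i≈0 i†i≈id g g∘i†f≈0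
    with coker-factor f (g ∘ i †) (≈-trans (assoc f (i †) g) g∘i†f≈0)
  ... | u , g∘i†≈u†∘coker = begin
    g                       ≈⟨ ≈-sym (identityʳ g) ⟩
    g ∘ id                  ≈⟨ ∘-resp-≈ ≈-refl (≈-sym i†i≈id) ⟩
    g ∘ (i † ∘ i)           ≈⟨ ≈-sym (assoc i (i †) g) ⟩
    (g ∘ i †) ∘ i           ≈⟨ ∘-resp-≈ g∘i†≈u†∘coker ≈-refl ⟩
    (u † ∘ coker f) ∘ i     ≈⟨ assoc i (coker f) (u †) ⟩
    u † ∘ (coker f ∘ i)     ≈⟨ ∘-resp-≈ ≈-refl cokerf∘i≈0 ⟩
    u † ∘ zero              ≈⟨ zeroʳ (u †) ⟩
    zero                    ∎

  coker-of-zeroEpi : ∀ {A B} (m : Hom A B) → IsZeroEpi m → coker m ≈ zero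
  coker-of-zeroEpi m m-zeroEpi = m-zeroEpi (coker m) (coker-annihilates m)

  id-isKernel-of-zero : ∀ {X Y} (c : Hom X Y) → c ≈ zero → IsKernel c id
  id-isKernel-of-zero c c≈0 =
      ≈-trans (identityʳ c) c≈0
    , λ g _ → g , identityˡ g , λ u′ id∘u′≈g → ≈-trans (≈-sym (identityˡ u′)) id∘u′≈g

  id-isDaggerMono : ∀ {X} → IsDaggerMono (id {X})
  id-isDaggerMono = ≈-trans (identityʳ (id †)) †-identity

  zeroEpi-isImageFactor : ∀ {A B} (m : Hom A B) → IsZeroEpi m → IsImageFactor m
  zeroEpi-isImageFactor {B = B} m m-zeroEpi =
      B , m , id
    , id-isKernel-of-zero (coker m) (coker-of-zeroEpi m m-zeroEpi)
    , id-isDaggerMono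
    , (begin
        m           ≈⟨ ≈-sym (identityˡ m) ⟩
        id ∘ m      ≈⟨ ∘-resp-≈ (≈-sym †-identity) ≈-refl ⟩
        id † ∘ m    ∎)

  imageFactor-isZeroEpi : ∀ {A B} (m : Hom A B) → IsImageFactor m → IsZeroEpi m
  imageFactor-isZeroEpi m (_ , f , i , (cokerf∘i≈0 , _) , i-daggerMono , m≈i†f) g g∘m≈0 =
    daggerMono-restriction-isZeroEpi f i cokerf∘i≈0 i-daggerMono g
      (≈-trans (∘-resp-≈ ≈-refl (≈-sym m≈i†f)) g∘m≈0)

proposition4p1 : ∀ {o h e : Level} (D : DaggerKernelCategory o h e) →
    let open DaggerKernelCategory D in
    ∀ {A B : Obj} (m : Hom A B) →
      (IsImageFactor m → IsZeroEpi m) × (IsZeroEpi m → IsImageFactor m)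
proposition4p1 D m = imageFactor-isZeroEpi m , zeroEpi-isImageFactor m
  where open DaggerKernelFacts D
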